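{- For every even integer $n\ge 2$, the digraph $\mathit{SB}(3,n)$ has no Hamiltonian cycle.
   Context: For integers $m,n\ge 1$, let $\Sigma_m=\{0,1,\dots,m-1\}$. The digraph $\mathit{SB}(m,n)$ has vertex set $\Sigma_m^n$ and, from each vertex $x_1x_2\dots x_n$, exactly two arcs: the "save" arc $x_1x_2\dots x_n\to x_2\dots x_n x_1$ and the "bump" arc $x_1x_2\dots x_n\to x_2\dots x_n x_1^+$, where $x_1^+=(x_1+1)\bmod m$. A Hamiltonian cycle is a directed cycle visiting every vertex exactly once. -}

module Defs where

open import Data.Nat using (ℕ; zero; suc; _^_; _%_; NonZero)
open import Data.Fin using (Fin; fromℕ<; toℕ)
open import Data.Vec using (Vec; _∷_; _∷ʳ_)
open import Data.Nat.DivMod using (m%n<n)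
open import Data.Product using (Σ; _×_; _,_)
open import Data.Sum using (_⊎_)
open import Function.Definitions using (Injective; Surjective)
open import Relation.Binary.PropositionalEquality using (_≡_)

-- Σ_m = Fin m ; vertices of SB(m,n) are words of length n over Σ_m.
-- Arcs are only meaningful for n ≥ 1 and m ≥ 1, so we index by suc.
Vertex : ℕ → ℕ → Set
Vertex m n = Vec (Fin m) n

bumpDigit : ∀ {m'} → Fin (suc m') → Fin (suc m')
bumpDigit {m'} x = fromℕ< (m%n<n (suc (toℕ x)) (suc m'))

save : ∀ {m n} → Vertex m (suc n) → Vertex m (suc n)
save (x ∷ xs) = xs ∷ʳ x

bump : ∀ {m' n} → Vertex (suc m') (suc n) → Vertex (suc m') (suc n)
bump (x ∷ xs) = xs ∷ʳ bumpDigit x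

Arc : ∀ {m' n} → Vertex (suc m') (suc n) → Vertex (suc m') (suc n) → Set
Arc u v = (v ≡ save u) ⊎ (v ≡ bump u)

nextIdx : ∀ {L} → Fin (suc L) → Fin (suc L)
nextIdx {L} i = fromℕ< (m%n<n (suc (toℕ i)) (suc L))

record HamiltonianCycle (m' n : ℕ) : Set where
  field
    len     : ℕ
    cyc     : Fin (suc len) → Vertex (suc m') (suc n)
    inj     : Injective _≡_ _≡_ cyc
    surj    : Surjective _≡_ _≡_ cyc
    arcs    : ∀ i → Arc (cyc i) (cyc (nextIdx i))

{-# OPTIONS --safe #-}
module Submission where

-- The successor map s of a Hamiltonian cycle of SB(3, n) permutes the 3ⁿ words in a single
-- cycle of odd length, so s is an even permutation. On the other hand, injectivity of s forces
-- it to treat the three words a·w alike: s(a·w) = w·a for all a, or s(a·w) = w·a⁺ for all a.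
-- Hence s = ρ ∘ β, where β bumps the first letter of a·w exactly when w is of the second kind
-- and ρ is the cyclic rotation of positions. β has order 3, so it is even. ρ is a product of
-- n − 1 transpositions of adjacent positions, and each of these acts on the words as a product
-- of 3ⁿ⁻¹ transpositions, so sign ρ = (−1)ⁿ⁻¹. Therefore n is odd.

open import Defs
open import Data.Nat using (ℕ; zero; suc; _+_; _*_; _^_; _%_; NonZero; parity)
open import Relation.Nullary using (¬_; contradiction; yes; no)

open import Data.Bool using (Bool; true; false; not; _∧_; _xor_)
open import Data.Bool.Properties
  using (xor-assoc; xor-same; not-distribˡ-xor; not-distribʳ-xor; not-involutive)
open import Data.Fin using (Fin; zero; suc; toℕ)
open import Data.Fin.Patterns using (0F; 1F; 2F)
open import Data.Fin.Permutation using (↔⇒≡)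
open import Data.Fin.Properties using (_≟_; <-cmp; toℕ-fromℕ<; toℕ-injective; toℕ<n; *↔×)
open import Data.Nat.DivMod using (%-distribˡ-+; m%n%n≡m%n; [m+n]%n≡m%n; m<n⇒m%n≡m)
open import Data.Nat.GeneralisedArithmetic using (fold; iterate; iterate-is-fold)
open import Data.Nat.Properties
  using ( +-identityʳ; +-suc; *-identityˡ; *-distribˡ-+; *-distribʳ-+; *-assoc
        ; *-cancelˡ-≡; +-0-commutativeMonoid; +-*-semiring; *-commutativeSemigroup)
open import Data.Parity using (Parity; 0ℙ; 1ℙ) renaming (_+_ to _+ℙ_; _*_ to _*ℙ_)
import Data.Parity.Properties as ℙ
open import Data.Product using (Σ-syntax; _×_; _,_; proj₁; proj₂; uncurry)
open import Data.Product.Function.NonDependent.Propositional using (_×-↔_)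
open import Data.Sum using (inj₁; inj₂)
open import Data.Vec using ([]; _∷_; _++_; _∷ʳ_; uncons; head)
open import Data.Vec.Properties using (≡-dec)
open import Function
  using (_∘_; id; _↔_; _⇔_; Inverse; Injection; Injective; mk⇔; mk↔ₛ′; mk⤖)
open import Function.Properties.Bijection using (⤖⇒↔)
open import Function.Properties.Inverse using (↔-refl; ↔-sym; ↔-trans; ↔⇒↣)
open import Relation.Binary.Definitions using (DecidableEquality; tri<; tri≈; tri>)
open import Relation.Binary.PropositionalEquality
open import Relation.Nullary.Decidable using (does; does-⇔)

open import Algebra.Properties.CommutativeSemigroup *-commutativeSemigroup using (x∙yz≈y∙xz)
import Algebra.Properties.CommutativeMonoid.Sum +-0-commutativeMonoid as FinSum
open FinSum using (sum-syntax)
open import Algebra.Properties.Semiring.Sum +-*-semiring using (*-distribˡ-sum)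

open Inverse using (to; from)

private variable
  k l m n : ℕ

-- Sums over words

𝟙 : Bool → ℕ
𝟙 true  = 1
𝟙 false = 0

𝟙-∧ : ∀ x y c → 𝟙 (x ∧ y) * c ≡ 𝟙 x * (𝟙 y * c)
𝟙-∧ true  y c = sym (+-identityʳ (𝟙 y * c))
𝟙-∧ false y c = refl

sum-const : ∀ m c → ∑[ _ < m ] c ≡ m * c
sum-const zero    c = refl
sum-const (suc m) c = cong (c +_) (sum-const m c)

sum-δ : (a : Fin m) (h : Fin m → ℕ) → ∑[ b < m ] (𝟙 (does (a ≟ b)) * h b) ≡ h a
sum-δ {suc m} zero    h = trans (cong₂ _+_ (+-identityʳ (h zero)) (FinSum.sum-replicate-zero m))
                                (+-identityʳ (h zero))
sum-δ {suc m} (suc a) h = sum-δ a (h ∘ suc)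

∑ᵛ : (Vertex m n → ℕ) → ℕ
∑ᵛ {n = zero}  f = f []
∑ᵛ {m} {suc n} f = ∑[ a < m ] ∑ᵛ[ w ] f (a ∷ w)

infix 10 ∑ᵛ
syntax ∑ᵛ (λ v → e) = ∑ᵛ[ v ] e

∑ᵛ-cong : {f g : Vertex m n → ℕ} → (∀ v → f v ≡ g v) → ∑ᵛ f ≡ ∑ᵛ g
∑ᵛ-cong {n = zero}  f≗g = f≗g []
∑ᵛ-cong {m} {suc n} f≗g = FinSum.sum-cong-≗ {m} λ a → ∑ᵛ-cong λ w → f≗g (a ∷ w)

∑ᵛ-distrib-+ : (f g : Vertex m n → ℕ) → ∑ᵛ[ v ] (f v + g v) ≡ ∑ᵛ f + ∑ᵛ g
∑ᵛ-distrib-+ {n = zero}  f g = refl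
∑ᵛ-distrib-+ {m} {suc n} f g = trans
  (FinSum.sum-cong-≗ {m} λ a → ∑ᵛ-distrib-+ (f ∘ (a ∷_)) (g ∘ (a ∷_)))
  (FinSum.∑-distrib-+ {m} (λ a → ∑ᵛ (f ∘ (a ∷_))) (λ a → ∑ᵛ (g ∘ (a ∷_))))

*-distribˡ-∑ᵛ : ∀ c (f : Vertex m n → ℕ) → c * ∑ᵛ f ≡ ∑ᵛ[ v ] (c * f v)
*-distribˡ-∑ᵛ {n = zero}  c f = refl
*-distribˡ-∑ᵛ {m} {suc n} c f = trans
  (*-distribˡ-sum {m} c λ a → ∑ᵛ (f ∘ (a ∷_)))
  (FinSum.sum-cong-≗ {m} λ a → *-distribˡ-∑ᵛ c (f ∘ (a ∷_)))

∑ᵛ-const : ∀ c → ∑ᵛ {m} {n} (λ _ → c) ≡ m ^ n * c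
∑ᵛ-const {n = zero}  c = sym (*-identityˡ c)
∑ᵛ-const {m} {suc n} c = begin
  ∑[ _ < m ] ∑ᵛ {m} {n} (λ _ → c)  ≡⟨ FinSum.sum-cong-≗ {m} (λ _ → ∑ᵛ-const {m} {n} c) ⟩
  ∑[ _ < m ] (m ^ n * c)            ≡⟨ sum-const m (m ^ n * c) ⟩
  m * (m ^ n * c)                   ≡⟨ *-assoc m (m ^ n) c ⟨
  m ^ suc n * c                     ∎
  where open ≡-Reasoning

∑ᵛ-∑ᵛ-const : ∀ n (g : Vertex m k → ℕ) → ∑ᵛ[ p ] ∑ᵛ {m} {n} (λ _ → g p) ≡ m ^ n * ∑ᵛ g
∑ᵛ-∑ᵛ-const {m} n g = trans (∑ᵛ-cong λ p → ∑ᵛ-const {m} {n} (g p)) (sym (*-distribˡ-∑ᵛ (m ^ n) g))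

∑ᵛ-comm : (h : Vertex k l → Vertex m n → ℕ) → ∑ᵛ[ u ] ∑ᵛ[ v ] h u v ≡ ∑ᵛ[ v ] ∑ᵛ[ u ] h u v
∑ᵛ-comm {l = zero}  h = refl
∑ᵛ-comm {k} {suc l} h = trans
  (FinSum.sum-cong-≗ {k} λ a → ∑ᵛ-comm λ u → h (a ∷ u))
  (sum-∑ᵛ-comm λ a v → ∑ᵛ[ u ] h (a ∷ u) v)
  where
  sum-∑ᵛ-comm : ∀ {n} (g : Fin k → Vertex m n → ℕ) → ∑[ a < k ] ∑ᵛ (g a) ≡ ∑ᵛ[ v ] ∑[ a < k ] g a v
  sum-∑ᵛ-comm {n = zero}  g = refl
  sum-∑ᵛ-comm {m} {suc n} g = trans
    (FinSum.∑-comm {k} {m} λ a b → ∑ᵛ λ w → g a (b ∷ w))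
    (FinSum.sum-cong-≗ {m} λ b → sum-∑ᵛ-comm λ a w → g a (b ∷ w))

_≟ᵛ_ : DecidableEquality (Vertex m n)
_≟ᵛ_ = ≡-dec _≟_

∑ᵛ-δ : (x : Vertex m n) (h : Vertex m n → ℕ) → ∑ᵛ[ v ] (𝟙 (does (x ≟ᵛ v)) * h v) ≡ h x
∑ᵛ-δ []                    h = +-identityʳ (h [])
∑ᵛ-δ {m} {suc n} (a ∷ x) h = begin
  ∑[ b < m ] ∑ᵛ[ v ] (𝟙 (does (a ≟ b) ∧ does (x ≟ᵛ v)) * h (b ∷ v))
    ≡⟨ FinSum.sum-cong-≗ {m} (λ b → ∑ᵛ-cong {m} {n} λ v →
         𝟙-∧ (does (a ≟ b)) (does (x ≟ᵛ v)) (h (b ∷ v))) ⟩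
  ∑[ b < m ] ∑ᵛ[ v ] (𝟙 (does (a ≟ b)) * (𝟙 (does (x ≟ᵛ v)) * h (b ∷ v)))
    ≡⟨ FinSum.sum-cong-≗ {m} (λ b →
         *-distribˡ-∑ᵛ (𝟙 (does (a ≟ b))) λ v → 𝟙 (does (x ≟ᵛ v)) * h (b ∷ v)) ⟨
  ∑[ b < m ] (𝟙 (does (a ≟ b)) * ∑ᵛ[ v ] (𝟙 (does (x ≟ᵛ v)) * h (b ∷ v)))
    ≡⟨ FinSum.sum-cong-≗ {m} (λ b → cong (𝟙 (does (a ≟ b)) *_) (∑ᵛ-δ x (h ∘ (b ∷_)))) ⟩
  ∑[ b < m ] (𝟙 (does (a ≟ b)) * h (b ∷ x))
    ≡⟨ sum-δ a (λ b → h (b ∷ x)) ⟩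
  h (a ∷ x) ∎
  where open ≡-Reasoning

∑ᵛ-reindex : (τ : Vertex k l ↔ Vertex m n) (h : Vertex m n → ℕ) → ∑ᵛ[ u ] h (to τ u) ≡ ∑ᵛ h
∑ᵛ-reindex {k} {l} τ h = begin
  ∑ᵛ[ u ] h (to τ u)
    ≡⟨ ∑ᵛ-cong (λ u → ∑ᵛ-δ (to τ u) h) ⟨
  ∑ᵛ[ u ] ∑ᵛ[ v ] (𝟙 (does (to τ u ≟ᵛ v)) * h v)
    ≡⟨ ∑ᵛ-comm (λ u v → 𝟙 (does (to τ u ≟ᵛ v)) * h v) ⟩
  ∑ᵛ[ v ] ∑ᵛ[ u ] (𝟙 (does (to τ u ≟ᵛ v)) * h v)
    ≡⟨ ∑ᵛ-cong (λ v → ∑ᵛ-cong {k} {l} λ u →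
         cong (λ b → 𝟙 b * h v) (does-⇔ to≡⇔≡from (to τ u ≟ᵛ v) (from τ v ≟ᵛ u))) ⟩
  ∑ᵛ[ v ] ∑ᵛ[ u ] (𝟙 (does (from τ v ≟ᵛ u)) * h v)
    ≡⟨ ∑ᵛ-cong (λ v → ∑ᵛ-δ (from τ v) (λ _ → h v)) ⟩
  ∑ᵛ h ∎
  where
  open ≡-Reasoning
  to≡⇔≡from : ∀ {u v} → to τ u ≡ v ⇔ from τ v ≡ u
  to≡⇔≡from = mk⇔ (λ e → Inverse.inverseʳ τ (sym e)) (λ e → Inverse.inverseˡ τ (sym e))

-- Lexicographic order and sums over pairs

infix 7 _<ˡ_

_<ˡ_ : Vertex m n → Vertex m n → Bool
[]      <ˡ []      = false
(a ∷ u) <ˡ (b ∷ v) with <-cmp a b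
... | tri< _ _ _ = true
... | tri≈ _ _ _ = u <ˡ v
... | tri> _ _ _ = false

<ˡ-irrefl : (u : Vertex m n) → u <ˡ u ≡ false
<ˡ-irrefl []      = refl
<ˡ-irrefl (a ∷ u) with <-cmp a a
... | tri< _ a≢a _ = contradiction refl a≢a
... | tri≈ _ _ _   = <ˡ-irrefl u
... | tri> _ a≢a _ = contradiction refl a≢a

<ˡ-flip : {u v : Vertex m n} → u ≢ v → v <ˡ u ≡ not (u <ˡ v)
<ˡ-flip {u = []}    {[]}    u≢v = contradiction refl u≢v
<ˡ-flip {u = a ∷ u} {b ∷ v} u≢v with <-cmp a b | <-cmp b a
... | tri< _ _ _    | tri> _ _ _   = refl
... | tri> _ _ _    | tri< _ _ _   = refl
... | tri≈ _ refl _ | tri≈ _ _ _   = <ˡ-flip (u≢v ∘ cong (a ∷_))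
... | tri< _ _ b≮a  | tri< b<a _ _ = contradiction b<a b≮a
... | tri< _ a≢b _  | tri≈ _ b≡a _ = contradiction (sym b≡a) a≢b
... | tri≈ _ a≡b _  | tri< _ b≢a _ = contradiction (sym a≡b) b≢a
... | tri≈ _ a≡b _  | tri> _ b≢a _ = contradiction (sym a≡b) b≢a
... | tri> _ a≢b _  | tri≈ _ b≡a _ = contradiction (sym b≡a) a≢b
... | tri> a≮b _ _  | tri> _ _ a<b = contradiction a<b a≮b

<ˡ-++-≡ : (p : Vertex m k) (u v : Vertex m n) → (p ++ u) <ˡ (p ++ v) ≡ u <ˡ v
<ˡ-++-≡ []      u v = refl
<ˡ-++-≡ (a ∷ p) u v with <-cmp a a
... | tri< _ a≢a _ = contradiction refl a≢a
... | tri≈ _ _ _   = <ˡ-++-≡ p u v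
... | tri> _ a≢a _ = contradiction refl a≢a

<ˡ-++-≢ : {p q : Vertex m k} → p ≢ q → (u v : Vertex m n) → (p ++ u) <ˡ (q ++ v) ≡ p <ˡ q
<ˡ-++-≢ {p = []}    {[]}    p≢q u v = contradiction refl p≢q
<ˡ-++-≢ {p = a ∷ p} {b ∷ q} p≢q u v with <-cmp a b
... | tri< _ _ _    = refl
... | tri≈ _ refl _ = <ˡ-++-≢ (p≢q ∘ cong (a ∷_)) u v
... | tri> _ _ _    = refl

∑< : (Vertex m n → Vertex m n → ℕ) → ℕ
∑< h = ∑ᵛ[ u ] ∑ᵛ[ v ] (𝟙 (u <ˡ v) * h u v)

∑<-cong : {g h : Vertex m n → Vertex m n → ℕ} → (∀ u v → g u v ≡ h u v) → ∑< g ≡ ∑< h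
∑<-cong g≗h = ∑ᵛ-cong λ u → ∑ᵛ-cong λ v → cong (𝟙 (u <ˡ v) *_) (g≗h u v)

∑<-distrib-+ : (g h : Vertex m n → Vertex m n → ℕ) → ∑< (λ u v → g u v + h u v) ≡ ∑< g + ∑< h
∑<-distrib-+ g h = begin
  ∑ᵛ[ u ] ∑ᵛ[ v ] (𝟙 (u <ˡ v) * (g u v + h u v))
    ≡⟨ ∑ᵛ-cong (λ u → ∑ᵛ-cong λ v → *-distribˡ-+ (𝟙 (u <ˡ v)) (g u v) (h u v)) ⟩
  ∑ᵛ[ u ] ∑ᵛ[ v ] (𝟙 (u <ˡ v) * g u v + 𝟙 (u <ˡ v) * h u v)
    ≡⟨ ∑ᵛ-cong (λ u → ∑ᵛ-distrib-+ (λ v → 𝟙 (u <ˡ v) * g u v) (λ v → 𝟙 (u <ˡ v) * h u v)) ⟩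
  ∑ᵛ[ u ] (∑ᵛ[ v ] (𝟙 (u <ˡ v) * g u v) + ∑ᵛ[ v ] (𝟙 (u <ˡ v) * h u v))
    ≡⟨ ∑ᵛ-distrib-+ (λ u → ∑ᵛ[ v ] (𝟙 (u <ˡ v) * g u v)) (λ u → ∑ᵛ[ v ] (𝟙 (u <ˡ v) * h u v)) ⟩
  ∑< g + ∑< h ∎
  where open ≡-Reasoning

*-distribˡ-∑< : ∀ c (h : Vertex m n → Vertex m n → ℕ) → c * ∑< h ≡ ∑< (λ u v → c * h u v)
*-distribˡ-∑< c h =
  trans (*-distribˡ-∑ᵛ c λ u → ∑ᵛ[ v ] (𝟙 (u <ˡ v) * h u v)) (∑ᵛ-cong λ u →
  trans (*-distribˡ-∑ᵛ c λ v → 𝟙 (u <ˡ v) * h u v) (∑ᵛ-cong λ v →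
  x∙yz≈y∙xz c (𝟙 (u <ˡ v)) (h u v)))

∑≢ : (Vertex m n → Vertex m n → ℕ) → ℕ
∑≢ h = ∑ᵛ[ u ] ∑ᵛ[ v ] (𝟙 (not (does (u ≟ᵛ v))) * h u v)

𝟙≢≡𝟙<+𝟙> : (u v : Vertex m n) → 𝟙 (not (does (u ≟ᵛ v))) ≡ 𝟙 (u <ˡ v) + 𝟙 (v <ˡ u)
𝟙≢≡𝟙<+𝟙> u v with u ≟ᵛ v
... | yes refl = sym (cong₂ _+_ (cong 𝟙 (<ˡ-irrefl u)) (cong 𝟙 (<ˡ-irrefl u)))
... | no u≢v   = sym (trans (cong (λ b → 𝟙 (u <ˡ v) + 𝟙 b) (<ˡ-flip u≢v)) (𝟙+𝟙not (u <ˡ v)))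
  where
  𝟙+𝟙not : ∀ b → 𝟙 b + 𝟙 (not b) ≡ 1
  𝟙+𝟙not true  = refl
  𝟙+𝟙not false = refl

∑≢≡2*∑< : (h : Vertex m n → Vertex m n → ℕ) → (∀ u v → h u v ≡ h v u) → ∑≢ h ≡ 2 * ∑< h
∑≢≡2*∑< h h-sym = begin
  ∑ᵛ[ u ] ∑ᵛ[ v ] (𝟙 (not (does (u ≟ᵛ v))) * h u v)
    ≡⟨ ∑ᵛ-cong (λ u → ∑ᵛ-cong λ v → trans (cong (_* h u v) (𝟙≢≡𝟙<+𝟙> u v))
                                          (*-distribʳ-+ (h u v) (𝟙 (u <ˡ v)) (𝟙 (v <ˡ u)))) ⟩
  ∑ᵛ[ u ] ∑ᵛ[ v ] (𝟙 (u <ˡ v) * h u v + 𝟙 (v <ˡ u) * h u v)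
    ≡⟨ ∑ᵛ-cong (λ u → ∑ᵛ-distrib-+ (λ v → 𝟙 (u <ˡ v) * h u v) (λ v → 𝟙 (v <ˡ u) * h u v)) ⟩
  ∑ᵛ[ u ] (∑ᵛ[ v ] (𝟙 (u <ˡ v) * h u v) + ∑ᵛ[ v ] (𝟙 (v <ˡ u) * h u v))
    ≡⟨ ∑ᵛ-distrib-+ (λ u → ∑ᵛ[ v ] (𝟙 (u <ˡ v) * h u v)) (λ u → ∑ᵛ[ v ] (𝟙 (v <ˡ u) * h u v)) ⟩
  ∑< h + ∑ᵛ[ u ] ∑ᵛ[ v ] (𝟙 (v <ˡ u) * h u v)
    ≡⟨ cong (∑< h +_) (∑ᵛ-comm λ u v → 𝟙 (v <ˡ u) * h u v) ⟩
  ∑< h + ∑ᵛ[ v ] ∑ᵛ[ u ] (𝟙 (v <ˡ u) * h u v)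
    ≡⟨ cong (∑< h +_) (∑<-cong λ v u → h-sym u v) ⟩
  ∑< h + ∑< h
    ≡⟨ cong (∑< h +_) (+-identityʳ (∑< h)) ⟨
  2 * ∑< h ∎
  where open ≡-Reasoning

∑≢-reindex : (τ : Vertex m n ↔ Vertex m n) (h : Vertex m n → Vertex m n → ℕ) →
             ∑≢ (λ u v → h (to τ u) (to τ v)) ≡ ∑≢ h
∑≢-reindex τ h = begin
  ∑ᵛ[ u ] ∑ᵛ[ v ] (𝟙 (not (does (u ≟ᵛ v))) * h (to τ u) (to τ v))
    ≡⟨ ∑ᵛ-cong (λ u → ∑ᵛ-cong λ v → cong (λ b → 𝟙 (not b) * h (to τ u) (to τ v))
         (does-⇔ (mk⇔ (cong (to τ)) (Injection.injective (↔⇒↣ τ))) (u ≟ᵛ v) (to τ u ≟ᵛ to τ v))) ⟩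
  ∑ᵛ[ u ] ∑ᵛ[ v ] g (to τ u) (to τ v)
    ≡⟨ ∑ᵛ-cong (λ u → ∑ᵛ-reindex τ (g (to τ u))) ⟩
  ∑ᵛ[ u ] ∑ᵛ[ v ] g (to τ u) v
    ≡⟨ ∑ᵛ-reindex τ (λ u → ∑ᵛ (g u)) ⟩
  ∑≢ h ∎
  where
  open ≡-Reasoning
  g : Vertex _ _ → Vertex _ _ → ℕ
  g u v = 𝟙 (not (does (u ≟ᵛ v))) * h u v

-- A bijection only permutes the unordered pairs {u, v}; ∑≢ visits each of them twice and is
-- visibly invariant.
∑<-reindex : (τ : Vertex m n ↔ Vertex m n) (h : Vertex m n → Vertex m n → ℕ) →
             (∀ u v → h u v ≡ h v u) → ∑< (λ u v → h (to τ u) (to τ v)) ≡ ∑< h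
∑<-reindex τ h h-sym = *-cancelˡ-≡ _ _ 2 (begin
  2 * ∑< (λ u v → h (to τ u) (to τ v)) ≡⟨ ∑≢≡2*∑< _ (λ u v → h-sym (to τ u) (to τ v)) ⟨
  ∑≢ (λ u v → h (to τ u) (to τ v))     ≡⟨ ∑≢-reindex τ h ⟩
  ∑≢ h                                 ≡⟨ ∑≢≡2*∑< h h-sym ⟩
  2 * ∑< h                             ∎)
  where open ≡-Reasoning

-- Sign of a permutation of words

Perm : ℕ → ℕ → Set
Perm m n = Vertex m n ↔ Vertex m n

discordant : (Vertex m n → Vertex m n) → Vertex m n → Vertex m n → Bool
discordant f u v = u <ˡ v xor f u <ˡ f v

inverted : (Vertex m n → Vertex m n) → Vertex m n → Vertex m n → ℕ
inverted f u v = 𝟙 (u <ˡ v) * 𝟙 (discordant f u v)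

inversions : (Vertex m n → Vertex m n) → ℕ
inversions f = ∑< λ u v → 𝟙 (discordant f u v)

sign : Perm m n → Parity
sign σ = parity (inversions (to σ))

discordant-sym : (σ : Perm m n) (u v : Vertex m n) → discordant (to σ) u v ≡ discordant (to σ) v u
discordant-sym σ u v with u ≟ᵛ v
... | yes refl = refl
... | no u≢v   = begin
  u <ˡ v xor to σ u <ˡ to σ v              ≡⟨ not-xor-not (u <ˡ v) (to σ u <ˡ to σ v) ⟨
  not (u <ˡ v) xor not (to σ u <ˡ to σ v)  ≡⟨ cong₂ _xor_ (<ˡ-flip u≢v) (<ˡ-flip σu≢σv) ⟨
  v <ˡ u xor to σ v <ˡ to σ u              ∎
  where
  open ≡-Reasoning
  σu≢σv : to σ u ≢ to σ v
  σu≢σv = u≢v ∘ Injection.injective (↔⇒↣ σ)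
  not-xor-not : ∀ x y → not x xor not y ≡ x xor y
  not-xor-not x y = trans (sym (not-distribˡ-xor x (not y)))
                          (trans (cong not (sym (not-distribʳ-xor x y))) (not-involutive (x xor y)))

discordant-∘ : (f g : Vertex m n → Vertex m n) (u v : Vertex m n) →
               discordant (g ∘ f) u v ≡ discordant f u v xor discordant g (f u) (f v)
discordant-∘ f g u v = sym (xor-cancel-middle (u <ˡ v) (f u <ˡ f v) (g (f u) <ˡ g (f v)))
  where
  xor-cancel-middle : ∀ x y z → (x xor y) xor (y xor z) ≡ x xor z
  xor-cancel-middle x y z = begin
    (x xor y) xor (y xor z)  ≡⟨ xor-assoc x y (y xor z) ⟩
    x xor (y xor (y xor z))  ≡⟨ cong (x xor_) (xor-assoc y y z) ⟨
    x xor ((y xor y) xor z)  ≡⟨ cong (λ b → x xor (b xor z)) (xor-same y) ⟩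
    x xor z                  ∎
    where open ≡-Reasoning

𝟙-xor : ∀ x y → 𝟙 (x xor y) + 2 * 𝟙 (x ∧ y) ≡ 𝟙 x + 𝟙 y
𝟙-xor true  true  = refl
𝟙-xor true  false = refl
𝟙-xor false true  = refl
𝟙-xor false false = refl

doublyDiscordant : (f g : Vertex m n → Vertex m n) → ℕ
doublyDiscordant f g = ∑< λ u v → 𝟙 (discordant f u v ∧ discordant g (f u) (f v))

inversions-∘ : (σ τ : Perm m n) →
               inversions (to σ ∘ to τ) + 2 * doublyDiscordant (to τ) (to σ) ≡
               inversions (to τ) + inversions (to σ)
inversions-∘ σ τ = begin
  ∑< (λ u v → 𝟙 (discordant (to σ ∘ to τ) u v)) + 2 * ∑< (λ u v → 𝟙 (D₁ u v ∧ D₂ u v))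
    ≡⟨ cong₂ _+_ (∑<-cong λ u v → cong 𝟙 (discordant-∘ (to τ) (to σ) u v))
                 (*-distribˡ-∑< 2 λ u v → 𝟙 (D₁ u v ∧ D₂ u v)) ⟩
  ∑< (λ u v → 𝟙 (D₁ u v xor D₂ u v)) + ∑< (λ u v → 2 * 𝟙 (D₁ u v ∧ D₂ u v))
    ≡⟨ ∑<-distrib-+ (λ u v → 𝟙 (D₁ u v xor D₂ u v)) (λ u v → 2 * 𝟙 (D₁ u v ∧ D₂ u v)) ⟨
  ∑< (λ u v → 𝟙 (D₁ u v xor D₂ u v) + 2 * 𝟙 (D₁ u v ∧ D₂ u v))
    ≡⟨ ∑<-cong (λ u v → 𝟙-xor (D₁ u v) (D₂ u v)) ⟩
  ∑< (λ u v → 𝟙 (D₁ u v) + 𝟙 (D₂ u v))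
    ≡⟨ ∑<-distrib-+ (λ u v → 𝟙 (D₁ u v)) (λ u v → 𝟙 (D₂ u v)) ⟩
  inversions (to τ) + ∑< (λ u v → 𝟙 (D₂ u v))
    ≡⟨ cong (inversions (to τ) +_) (∑<-reindex τ (λ x y → 𝟙 (discordant (to σ) x y))
                                                  (λ x y → cong 𝟙 (discordant-sym σ x y))) ⟩
  inversions (to τ) + inversions (to σ) ∎
  where
  open ≡-Reasoning
  D₁ D₂ : Vertex _ _ → Vertex _ _ → Bool
  D₁     = discordant (to τ)
  D₂ u v = discordant (to σ) (to τ u) (to τ v)

sign-∘ : (τ σ : Perm m n) → sign (↔-trans τ σ) ≡ sign τ +ℙ sign σ
sign-∘ τ σ = begin
  parity (inversions (to σ ∘ to τ))
    ≡⟨ parity-+-even (inversions (to σ ∘ to τ)) (doublyDiscordant (to τ) (to σ)) ⟨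
  parity (inversions (to σ ∘ to τ) + 2 * doublyDiscordant (to τ) (to σ))
    ≡⟨ cong parity (inversions-∘ σ τ) ⟩
  parity (inversions (to τ) + inversions (to σ))
    ≡⟨ ℙ.+-homo-+ (inversions (to τ)) (inversions (to σ)) ⟩
  sign τ +ℙ sign σ ∎
  where
  open ≡-Reasoning
  parity-+-even : ∀ a b → parity (a + 2 * b) ≡ parity a
  parity-+-even a b = trans (ℙ.+-homo-+ a (2 * b))
    (trans (cong (parity a +ℙ_) (ℙ.*-homo-* 2 b)) (ℙ.+-identityʳ (parity a)))

inversions-cong : {f g : Vertex m n → Vertex m n} → (∀ v → f v ≡ g v) → inversions f ≡ inversions g
inversions-cong f≗g = ∑<-cong λ u v → cong (λ b → 𝟙 (u <ˡ v xor b)) (cong₂ _<ˡ_ (f≗g u) (f≗g v))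

sign-cong : {σ τ : Perm m n} → (∀ v → to σ v ≡ to τ v) → sign σ ≡ sign τ
sign-cong σ≗τ = cong parity (inversions-cong σ≗τ)

sign-id : sign (↔-refl {A = Vertex m n}) ≡ 0ℙ
sign-id {m} {n} = trans (sign-∘ ι ι) (ℙ.p+p≡0ℙ (sign ι))
  where
  ι : Perm m n
  ι = ↔-refl

infixl 8 _^ᵖ_

_^ᵖ_ : Perm m n → ℕ → Perm m n
σ ^ᵖ zero  = ↔-refl
σ ^ᵖ suc k = ↔-trans (σ ^ᵖ k) σ

^ᵖ≗fold : (σ : Perm m n) (f : Vertex m n → Vertex m n) → (∀ v → to σ v ≡ f v) →
          ∀ k v → to (σ ^ᵖ k) v ≡ fold v f k
^ᵖ≗fold σ f σ≗f zero    v = refl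
^ᵖ≗fold σ f σ≗f (suc k) v = trans (cong (to σ) (^ᵖ≗fold σ f σ≗f k v)) (σ≗f (fold v f k))

sign-^ᵖ : (σ : Perm m n) (k : ℕ) → sign (σ ^ᵖ k) ≡ parity k *ℙ sign σ
sign-^ᵖ {m} {n} σ zero    = sign-id {m} {n}
sign-^ᵖ         σ (suc k) = begin
  sign (↔-trans (σ ^ᵖ k) σ)        ≡⟨ sign-∘ (σ ^ᵖ k) σ ⟩
  sign (σ ^ᵖ k) +ℙ sign σ          ≡⟨ cong (_+ℙ sign σ) (sign-^ᵖ σ k) ⟩
  (parity k *ℙ sign σ) +ℙ sign σ   ≡⟨ ℙ.+-comm (parity k *ℙ sign σ) (sign σ) ⟩
  sign σ +ℙ (parity k *ℙ sign σ)   ≡⟨ ℙ.*-distribʳ-+ (sign σ) 1ℙ (parity k) ⟨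
  (1ℙ +ℙ parity k) *ℙ sign σ       ≡⟨ cong (_*ℙ sign σ) (ℙ.+-homo-+ 1 k) ⟨
  parity (suc k) *ℙ sign σ         ∎
  where open ≡-Reasoning

sign-odd-order : (σ : Perm m n) (k : ℕ) → (∀ v → to (σ ^ᵖ k) v ≡ v) → parity k ≡ 1ℙ → sign σ ≡ 0ℙ
sign-odd-order {m} {n} σ k σᵏ≗id k-odd = begin
  sign σ                          ≡⟨ cong (_*ℙ sign σ) k-odd ⟨
  parity k *ℙ sign σ              ≡⟨ sign-^ᵖ σ k ⟨
  sign (σ ^ᵖ k)                   ≡⟨ sign-cong {σ = σ ^ᵖ k} {↔-refl} σᵏ≗id ⟩
  sign (↔-refl {A = Vertex m n})  ≡⟨ sign-id {m} {n} ⟩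
  0ℙ                              ∎
  where open ≡-Reasoning

𝟙-xor-same : ∀ x → 𝟙 x * 𝟙 (x xor x) ≡ 0
𝟙-xor-same true  = refl
𝟙-xor-same false = refl

-- Rotations and bumps

onTail : Perm m n → Perm m (suc n)
onTail σ = mk↔ₛ′ (λ { (a ∷ w) → a ∷ to σ w }) (λ { (a ∷ w) → a ∷ from σ w })
  (λ { (a ∷ w) → cong (a ∷_) (Inverse.strictlyInverseˡ σ w) })
  (λ { (a ∷ w) → cong (a ∷_) (Inverse.strictlyInverseʳ σ w) })

inverted-onTail : (σ : Perm m n) (a b : Fin m) (u v : Vertex m n) →
                  inverted (to (onTail σ)) (a ∷ u) (b ∷ v) ≡ 𝟙 (does (a ≟ b)) * inverted (to σ) u v
inverted-onTail σ a b u v with a ≟ b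
... | yes refl = trans
  (cong₂ (λ x y → 𝟙 x * 𝟙 (x xor y)) (<ˡ-++-≡ (a ∷ []) u v) (<ˡ-++-≡ (a ∷ []) (to σ u) (to σ v)))
  (sym (*-identityˡ (inverted (to σ) u v)))
... | no a≢b = trans
  (cong₂ (λ x y → 𝟙 x * 𝟙 (x xor y)) (<ˡ-++-≢ [a]≢[b] u v) (<ˡ-++-≢ [a]≢[b] (to σ u) (to σ v)))
  (𝟙-xor-same ((a ∷ []) <ˡ (b ∷ [])))
  where
  [a]≢[b] : a ∷ [] ≢ b ∷ []
  [a]≢[b] refl = a≢b refl

inversions-onTail : (σ : Perm m n) → inversions (to (onTail σ)) ≡ m * inversions (to σ)
inversions-onTail {m} σ = begin
  ∑[ a < m ] ∑ᵛ[ u ] ∑[ b < m ] ∑ᵛ[ v ] inverted (to (onTail σ)) (a ∷ u) (b ∷ v)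
    ≡⟨ FinSum.sum-cong-≗ {m} (λ a → ∑ᵛ-cong λ u → FinSum.sum-cong-≗ {m} λ b →
         trans (∑ᵛ-cong λ v → inverted-onTail σ a b u v)
               (sym (*-distribˡ-∑ᵛ (𝟙 (does (a ≟ b))) (inverted (to σ) u)))) ⟩
  ∑[ a < m ] ∑ᵛ[ u ] ∑[ b < m ] (𝟙 (does (a ≟ b)) * ∑ᵛ (inverted (to σ) u))
    ≡⟨ FinSum.sum-cong-≗ {m} (λ a → ∑ᵛ-cong λ u → sum-δ a λ _ → ∑ᵛ (inverted (to σ) u)) ⟩
  ∑[ a < m ] inversions (to σ)
    ≡⟨ sum-const m (inversions (to σ)) ⟩
  m * inversions (to σ) ∎
  where open ≡-Reasoning

sign-onTail : (σ : Perm m n) → sign (onTail σ) ≡ parity m *ℙ sign σ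
sign-onTail {m} σ = trans (cong parity (inversions-onTail σ)) (ℙ.*-homo-* m (inversions (to σ)))

swap₀₁ : Perm m (suc (suc n))
swap₀₁ = mk↔ₛ′ swap swap swap-involutive swap-involutive
  where
  swap : Vertex _ (suc (suc _)) → Vertex _ (suc (suc _))
  swap (a ∷ b ∷ w) = b ∷ a ∷ w
  swap-involutive : ∀ v → swap (swap v) ≡ v
  swap-involutive (a ∷ b ∷ w) = refl

inverted-swap₀₁ : (p q : Vertex m 2) (u v : Vertex m n) →
                  inverted (to swap₀₁) (p ++ u) (q ++ v) ≡ inverted (to swap₀₁) p q
inverted-swap₀₁ p@(a ∷ b ∷ []) q@(c ∷ d ∷ []) u v with p ≟ᵛ q
... | yes refl = begin
  inverted (to swap₀₁) (p ++ u) (p ++ v)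
    ≡⟨ cong₂ (λ x y → 𝟙 x * 𝟙 (x xor y)) (<ˡ-++-≡ p u v) (<ˡ-++-≡ (b ∷ a ∷ []) u v) ⟩
  𝟙 (u <ˡ v) * 𝟙 (u <ˡ v xor u <ˡ v)
    ≡⟨ 𝟙-xor-same (u <ˡ v) ⟩
  0
    ≡⟨ cong (λ x → 𝟙 x * 𝟙 (discordant (to swap₀₁) p p)) (<ˡ-irrefl p) ⟨
  inverted (to swap₀₁) p p ∎
  where open ≡-Reasoning
... | no p≢q = cong₂ (λ x y → 𝟙 x * 𝟙 (x xor y)) (<ˡ-++-≢ p≢q u v) (<ˡ-++-≢ swapped≢ u v)
  where
  swapped≢ : b ∷ a ∷ [] ≢ d ∷ c ∷ []
  swapped≢ refl = p≢q refl

inversions-swap₀₁ : inversions (to (swap₀₁ {m} {n})) ≡ m ^ n * (m ^ n * inversions (to (swap₀₁ {m} {0})))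
inversions-swap₀₁ {m} {n} = begin
  inversions (to (swap₀₁ {m} {n}))
    ≡⟨⟩
  (∑₂ λ p → ∑ₙ λ u → ∑₂ λ q → ∑ₙ λ v → inverted (to swap₀₁) (p ++ u) (q ++ v))
    ≡⟨ ∑ᵛ-cong {m} {2} (λ p → ∑ᵛ-cong λ u → ∑ᵛ-cong λ q → ∑ᵛ-cong λ v → inverted-swap₀₁ {n = n} p q u v) ⟩
  (∑₂ λ p → ∑ₙ λ _ → ∑₂ λ q → ∑ₙ λ _ → I₂ p q)
    ≡⟨ ∑ᵛ-∑ᵛ-const n (λ p → ∑₂ λ q → ∑ₙ λ _ → I₂ p q) ⟩
  m ^ n * (∑₂ λ p → ∑₂ λ q → ∑ₙ λ _ → I₂ p q)
    ≡⟨ cong (m ^ n *_) (∑ᵛ-cong λ p → ∑ᵛ-∑ᵛ-const n (I₂ p)) ⟩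
  m ^ n * (∑₂ λ p → m ^ n * ∑₂ (I₂ p))
    ≡⟨ cong (m ^ n *_) (*-distribˡ-∑ᵛ (m ^ n) (λ p → ∑₂ (I₂ p))) ⟨
  m ^ n * (m ^ n * inversions (to (swap₀₁ {m} {0}))) ∎
  where
  open ≡-Reasoning
  I₂ : Vertex m 2 → Vertex m 2 → ℕ
  I₂ = inverted (to swap₀₁)
  ∑₂ : (Vertex m 2 → ℕ) → ℕ
  ∑₂ = ∑ᵛ
  ∑ₙ : (Vertex m n → ℕ) → ℕ
  ∑ₙ = ∑ᵛ

parity-3^ : ∀ n → parity (3 ^ n) ≡ 1ℙ
parity-3^ zero    = refl
parity-3^ (suc n) = trans (ℙ.*-homo-* 3 (3 ^ n)) (parity-3^ n)

-- inversions (to (swap₀₁ {3} {0})) evaluates to 9, the number of pairs ab <ˡ cd with a < c and b > d.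
sign-swap₀₁ : sign (swap₀₁ {3} {n}) ≡ 1ℙ
sign-swap₀₁ {n} = begin
  parity (inversions (to (swap₀₁ {3} {n})))  ≡⟨ cong parity (inversions-swap₀₁ {3} {n}) ⟩
  parity (3 ^ n * (3 ^ n * 9))               ≡⟨ ℙ.*-homo-* (3 ^ n) (3 ^ n * 9) ⟩
  parity (3 ^ n) *ℙ parity (3 ^ n * 9)       ≡⟨ cong₂ _*ℙ_ (parity-3^ n) (ℙ.*-homo-* (3 ^ n) 9) ⟩
  1ℙ *ℙ (parity (3 ^ n) *ℙ 1ℙ)               ≡⟨ cong (_*ℙ 1ℙ) (parity-3^ n) ⟩
  1ℙ                                         ∎
  where open ≡-Reasoning

rotate : ∀ n → Perm m (suc n)
rotate zero    = ↔-refl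
rotate (suc n) = ↔-trans swap₀₁ (onTail (rotate n))

rotate≗save : ∀ n (v : Vertex m (suc n)) → to (rotate n) v ≡ save v
rotate≗save zero    (a ∷ [])    = refl
rotate≗save (suc n) (a ∷ b ∷ w) = cong (b ∷_) (rotate≗save n (a ∷ w))

sign-rotate : ∀ n → sign (rotate {3} n) ≡ parity n
sign-rotate zero    = sign-id {3} {1}
sign-rotate (suc n) = begin
  sign (↔-trans swap₀₁ (onTail (rotate {3} n)))
    ≡⟨ sign-∘ (swap₀₁ {3} {n}) (onTail (rotate n)) ⟩
  sign (swap₀₁ {3} {n}) +ℙ sign (onTail (rotate {3} n))
    ≡⟨ cong₂ _+ℙ_ (sign-swap₀₁ {n}) (sign-onTail (rotate {3} n)) ⟩
  1ℙ +ℙ (1ℙ *ℙ sign (rotate {3} n))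
    ≡⟨ cong (1ℙ +ℙ_) (sign-rotate n) ⟩
  1ℙ +ℙ parity n
    ≡⟨ ℙ.+-homo-+ 1 n ⟨
  parity (suc n) ∎
  where open ≡-Reasoning

bumpDigitIf : Bool → Fin (suc m) → Fin (suc m)
bumpDigitIf true  = bumpDigit
bumpDigitIf false = id

bumpDigitIf³ : ∀ b (a : Fin 3) → bumpDigitIf b (bumpDigitIf b (bumpDigitIf b a)) ≡ a
bumpDigitIf³ true  0F = refl
bumpDigitIf³ true  1F = refl
bumpDigitIf³ true  2F = refl
bumpDigitIf³ false a  = refl

bumpHeadWhen : (Vertex 3 n → Bool) → Perm 3 (suc n)
bumpHeadWhen c = mk↔ₛ′ β (β ∘ β) β³≗id β³≗id
  where
  β : Vertex 3 (suc _) → Vertex 3 (suc _)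
  β (a ∷ w) = bumpDigitIf (c w) a ∷ w
  β³≗id : ∀ v → β (β (β v)) ≡ v
  β³≗id (a ∷ w) = cong (_∷ w) (bumpDigitIf³ (c w) a)

-- The inverse of β is β ∘ β, so strictlyInverseʳ says β³ = id.
sign-bumpHeadWhen : (c : Vertex 3 n → Bool) → sign (bumpHeadWhen c) ≡ 0ℙ
sign-bumpHeadWhen c = sign-odd-order (bumpHeadWhen c) 3 (Inverse.strictlyInverseʳ (bumpHeadWhen c)) refl

-- Hamiltonian cycles

-- With mixed arcs, two of the words 0·w, 1·w, 2·w would have the same successor.
arcs-uniform : (f : Vertex 3 (suc n) → Vertex 3 (suc n)) → Injective _≡_ _≡_ f → (∀ v → Arc v (f v)) →
               ∀ w → Σ[ b ∈ Bool ] ∀ a → f (a ∷ w) ≡ w ∷ʳ bumpDigitIf b a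
arcs-uniform f f-inj arc w = uniform (arc (0F ∷ w)) (arc (1F ∷ w)) (arc (2F ∷ w))
  where
  collision : ∀ {A : Set} {a b} → a ≢ b → f (a ∷ w) ≡ f (b ∷ w) → A
  collision a≢b e = contradiction (cong head (f-inj e)) a≢b
  uniform : Arc (0F ∷ w) (f (0F ∷ w)) → Arc (1F ∷ w) (f (1F ∷ w)) → Arc (2F ∷ w) (f (2F ∷ w)) →
            Σ[ b ∈ Bool ] ∀ a → f (a ∷ w) ≡ w ∷ʳ bumpDigitIf b a
  uniform (inj₁ e₀) (inj₁ e₁) (inj₁ e₂) = false , λ { 0F → e₀ ; 1F → e₁ ; 2F → e₂ }
  uniform (inj₂ e₀) (inj₂ e₁) (inj₂ e₂) = true  , λ { 0F → e₀ ; 1F → e₁ ; 2F → e₂ }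
  uniform (inj₁ e₀) (inj₁ _)  (inj₂ e₂) = collision (λ ()) (trans e₀ (sym e₂))
  uniform (inj₁ _)  (inj₂ e₁) (inj₁ e₂) = collision (λ ()) (trans e₁ (sym e₂))
  uniform (inj₂ e₀) (inj₁ e₁) (inj₁ _)  = collision (λ ()) (trans e₀ (sym e₁))
  uniform (inj₁ e₀) (inj₂ _)  (inj₂ e₂) = collision (λ ()) (trans e₀ (sym e₂))
  uniform (inj₂ e₀) (inj₁ e₁) (inj₂ _)  = collision (λ ()) (trans e₀ (sym e₁))
  uniform (inj₂ _)  (inj₂ e₁) (inj₁ e₂) = collision (λ ()) (trans e₁ (sym e₂))

arcs⇒rotate∘bumpHeadWhen :
  (f : Vertex 3 (suc n) → Vertex 3 (suc n)) → Injective _≡_ _≡_ f → (∀ v → Arc v (f v)) →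
  Σ[ c ∈ (Vertex 3 n → Bool) ] ∀ v → to (↔-trans (bumpHeadWhen c) (rotate n)) v ≡ f v
arcs⇒rotate∘bumpHeadWhen {n} f f-inj arc =
  proj₁ ∘ uniform , λ { (a ∷ w) → trans (rotate≗save n _) (sym (proj₂ (uniform w) a)) }
  where
  uniform : ∀ w → Σ[ b ∈ Bool ] ∀ a → f (a ∷ w) ≡ w ∷ʳ bumpDigitIf b a
  uniform = arcs-uniform f f-inj arc

sign-rotate∘bumpHeadWhen : (c : Vertex 3 n → Bool) → sign (↔-trans (bumpHeadWhen c) (rotate n)) ≡ parity n
sign-rotate∘bumpHeadWhen {n} c =
  trans (sign-∘ (bumpHeadWhen c) (rotate n)) (cong₂ _+ℙ_ (sign-bumpHeadWhen c) (sign-rotate n))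

periodic⇒injective : ∀ {A : Set} {f : A → A} k → (∀ x → fold x f (suc k) ≡ x) → Injective _≡_ _≡_ f
periodic⇒injective {f = f} k period {x} {y} fx≡fy = begin
  x                  ≡⟨ period x ⟨
  fold x f (suc k)   ≡⟨ iterate-is-fold x f (suc k) ⟩
  iterate f (f x) k  ≡⟨ cong (λ z → iterate f z k) fx≡fy ⟩
  iterate f (f y) k  ≡⟨ iterate-is-fold y f (suc k) ⟨
  fold y f (suc k)   ≡⟨ period y ⟩
  y                  ∎
  where open ≡-Reasoning

odd-period-along-arcs⇒even : (f : Vertex 3 (suc n) → Vertex 3 (suc n)) → (∀ v → Arc v (f v)) →
                             ∀ k → (∀ v → fold v f (suc k) ≡ v) → parity (suc k) ≡ 1ℙ → parity n ≡ 0ℙ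
odd-period-along-arcs⇒even {n} f arc k period odd-period
  with arcs⇒rotate∘bumpHeadWhen f (periodic⇒injective k period) arc
... | c , ρβ≗f = begin
  parity n  ≡⟨ sign-rotate∘bumpHeadWhen c ⟨
  sign ρβ   ≡⟨ sign-odd-order ρβ (suc k) ρβ-period odd-period ⟩
  0ℙ        ∎
  where
  open ≡-Reasoning
  ρβ : Perm 3 (suc n)
  ρβ = ↔-trans (bumpHeadWhen c) (rotate n)
  ρβ-period : ∀ v → to (ρβ ^ᵖ suc k) v ≡ v
  ρβ-period v = trans (^ᵖ≗fold ρβ f ρβ≗f (suc k) v) (period v)

vertex↔fin : ∀ m n → Vertex m n ↔ Fin (m ^ n)
vertex↔fin m zero    = mk↔ₛ′ (λ _ → zero) (λ _ → []) (λ { zero → refl }) (λ { [] → refl })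
vertex↔fin m (suc n) = ↔-trans uncons↔ (↔-trans (↔-refl ×-↔ vertex↔fin m n) (↔-sym *↔×))
  where
  uncons↔ : Vertex m (suc n) ↔ (Fin m × Vertex m n)
  uncons↔ = mk↔ₛ′ uncons (uncurry _∷_) (λ _ → refl) (λ { (a ∷ w) → refl })

suc-%-% : ∀ x N .{{_ : NonZero N}} → suc (x % N) % N ≡ suc x % N
suc-%-% x N = begin
  (1 + x % N) % N          ≡⟨ %-distribˡ-+ 1 (x % N) N ⟩
  (1 % N + x % N % N) % N  ≡⟨ cong (λ y → (1 % N + y) % N) (m%n%n≡m%n x N) ⟩
  (1 % N + x % N) % N      ≡⟨ %-distribˡ-+ 1 x N ⟨
  (1 + x) % N              ∎
  where open ≡-Reasoning

toℕ-fold-nextIdx : ∀ {L} (i : Fin (suc L)) k → toℕ (fold i nextIdx k) ≡ (toℕ i + k) % suc L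
toℕ-fold-nextIdx {L} i zero    = sym (trans (cong (_% suc L) (+-identityʳ (toℕ i))) (m<n⇒m%n≡m (toℕ<n i)))
toℕ-fold-nextIdx {L} i (suc k) = begin
  toℕ (nextIdx (fold i nextIdx k))      ≡⟨ toℕ-fromℕ< _ ⟩
  suc (toℕ (fold i nextIdx k)) % suc L  ≡⟨ cong (λ x → suc x % suc L) (toℕ-fold-nextIdx i k) ⟩
  suc ((toℕ i + k) % suc L) % suc L     ≡⟨ suc-%-% (toℕ i + k) (suc L) ⟩
  suc (toℕ i + k) % suc L               ≡⟨ cong (_% suc L) (+-suc (toℕ i) k) ⟨
  (toℕ i + suc k) % suc L               ∎
  where open ≡-Reasoning

fold-nextIdx-period : ∀ {L} (i : Fin (suc L)) → fold i nextIdx (suc L) ≡ i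
fold-nextIdx-period {L} i = toℕ-injective (begin
  toℕ (fold i nextIdx (suc L))  ≡⟨ toℕ-fold-nextIdx i (suc L) ⟩
  (toℕ i + suc L) % suc L       ≡⟨ [m+n]%n≡m%n (toℕ i) (suc L) ⟩
  toℕ i % suc L                 ≡⟨ m<n⇒m%n≡m (toℕ<n i) ⟩
  toℕ i                         ∎)
  where open ≡-Reasoning

module _ {n} (H : HamiltonianCycle 2 n) where
  open HamiltonianCycle H

  private
    cycle↔ : Fin (suc len) ↔ Vertex 3 (suc n)
    cycle↔ = ⤖⇒↔ (mk⤖ (inj , surj))

    cyc-from : ∀ v → cyc (from cycle↔ v) ≡ v
    cyc-from = Inverse.strictlyInverseˡ cycle↔

  successor : Vertex 3 (suc n) → Vertex 3 (suc n)
  successor v = cyc (nextIdx (from cycle↔ v))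

  length≡3^ : suc len ≡ 3 ^ suc n
  length≡3^ = ↔⇒≡ (↔-trans cycle↔ (vertex↔fin 3 (suc n)))

  successor-arc : ∀ v → Arc v (successor v)
  successor-arc v = subst (λ x → Arc x (successor v)) (cyc-from v) (arcs (from cycle↔ v))

  fold-successor : ∀ i k → fold (cyc i) successor k ≡ cyc (fold i nextIdx k)
  fold-successor i zero    = refl
  fold-successor i (suc k) = trans (cong successor (fold-successor i k))
                                   (cong (cyc ∘ nextIdx) (Inverse.strictlyInverseʳ cycle↔ _))

  successor-period : ∀ v → fold v successor (suc len) ≡ v
  successor-period v = begin
    fold v successor (suc len)
      ≡⟨ cong (λ x → fold x successor (suc len)) (cyc-from v) ⟨
    fold (cyc (from cycle↔ v)) successor (suc len)
      ≡⟨ fold-successor (from cycle↔ v) (suc len) ⟩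
    cyc (fold (from cycle↔ v) nextIdx (suc len))
      ≡⟨ cong cyc (fold-nextIdx-period (from cycle↔ v)) ⟩
    cyc (from cycle↔ v)
      ≡⟨ cyc-from v ⟩
    v ∎
    where open ≡-Reasoning

-- HamiltonianCycle 2 n is about SB(3, n + 1).
hamiltonian⇒even : HamiltonianCycle 2 n → parity n ≡ 0ℙ
hamiltonian⇒even {n} H = odd-period-along-arcs⇒even (successor H) (successor-arc H) len (successor-period H)
                                                    (trans (cong parity (length≡3^ H)) (parity-3^ (suc n)))
  where open HamiltonianCycle H using (len)

corollary5p2 : ∀ (k : ℕ) → ¬ HamiltonianCycle 2 (suc (2 * k))
corollary5p2 k H = contradiction (trans (sym (hamiltonian⇒even H)) parity-1+2k) λ ()
  where
  parity-1+2k : parity (suc (2 * k)) ≡ 1ℙ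
  parity-1+2k = trans (ℙ.+-homo-+ 1 (2 * k)) (cong (1ℙ +ℙ_) (ℙ.*-homo-* 2 k))
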